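{- Let $n\geqslant1$, $X\subseteq\mathbb{Z}_n\setminus\{0\}$, $\zeta_n$ a primitive $n$-th root of unity and $\mathbf{r}(z)=\sum_{i\in X}\zeta_n^{iz}$ for $z\in\mathbb{Z}_n$. Then $Dih(n,X,X)$ is a DSRG with parameters $(2n,2|X|,\mu,\lambda,t)$ if and only if $t=\mu$ and, for all $z\in\mathbb{Z}_n$, $\mathbf{r}(z)\big(\mathbf{r}(z)+\overline{\mathbf{r}(z)}\big)=\mu n\,\delta_{z,0}+(\lambda-\mu)\mathbf{r}(z)$.
   Context: $D_n=\langle x,a\mid x^n=1,\ a^2=1,\ ax=x^{ -1}a\rangle$; $Dih(n,X,Y)$ is the Cayley digraph on $D_n$ with connection set $\{x^i:i\in X\}\cup\{x^ja:j\in Y\}$. A DSRG with parameters $(N,k,\mu,\lambda,t)$: adjacency matrix $A$ with $AJ=JA=kJ$ and $A^2=tI+\lambda A+\mu(J-I-A)$. $\delta_{z,0}$ is the indicator of $z=0$; bar is complex conjugation. -}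

module Defs where

open import Level using (Level; _⊔_) renaming (suc to lsuc)
open import Data.Bool using (Bool; true; false; if_then_else_; not)
open import Data.Nat as ℕ using (ℕ; zero; suc; _<_)
open import Data.Nat.DivMod using (_mod_)
open import Data.Fin as F using (Fin; toℕ)
open import Data.Fin.Subset using (Subset; _∈_)
open import Data.Fin.Subset.Properties using (_∈?_)
open import Data.Integer as ℤ using (ℤ; +_)
open import Data.List using (List; []; _∷_; _++_; map; foldr; length; allFin)
open import Data.Product using (_×_; _,_; ∃)
open import Relation.Nullary using (¬_; does)
open import Relation.Binary.PropositionalEquality using (_≡_)
open import Algebra.Bundles using (CommutativeRing; Semiring)
open import Algebra.Morphism.Structures using (module RingMorphisms)
import Algebra.Definitions.RawSemiring as RS

-- The dihedral group D_n = ⟨ x, a | x^n = 1, a^2 = 1, a x = x^{-1} a ⟩.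
-- The element (i , false) stands for x^i and (i , true) for x^i a.

D : ℕ → Set
D n = Fin n × Bool

_+ₘ_ : {n : ℕ} → Fin n → Fin n → Fin n
_+ₘ_ {suc m} i j = (toℕ i ℕ.+ toℕ j) mod suc m

-ₘ_ : {n : ℕ} → Fin n → Fin n
-ₘ_ {suc m} i = (suc m ℕ.∸ toℕ i) mod suc m

_-ₘ_ : {n : ℕ} → Fin n → Fin n → Fin n
i -ₘ j = i +ₘ (-ₘ j)

module _ {n : ℕ} where

  _·D_ : D n → D n → D n
  (i , false) ·D (j , f) = (i +ₘ j , f)
  (i , true)  ·D (j , f) = (i -ₘ j , not f)      -- x^i a · x^j a^f = x^(i-j) a^(1+f)

  invD : D n → D n
  invD (i , false) = (-ₘ i , false)
  invD (i , true)  = (i , true)                   -- (x^i a)^{-1} = x^i a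

elemsD : (n : ℕ) → List (D n)
elemsD n = map (λ i → (i , false)) (allFin n) ++ map (λ i → (i , true)) (allFin n)

-- Cayley digraph Cay(G,S): arc g → h iff g^{-1} h ∈ S.
-- Dih(n,X,Y): connection set {x^i : i ∈ X} ∪ {x^j a : j ∈ Y}.
inConn : {n : ℕ} → Subset n → Subset n → D n → Bool
inConn X Y (i , false) = does (i ∈? X)
inConn X Y (j , true)  = does (j ∈? Y)

Dih : (n : ℕ) → Subset n → Subset n → D n → D n → ℤ
Dih n X Y g h = if inConn X Y (invD g ·D h) then + 1 else + 0

-- Directed strongly regular graphs, for a digraph on a finite vertex
-- type V given by a complete duplicate-free enumeration `vs`.

sumℤ : {V : Set} → List V → (V → ℤ) → ℤ
sumℤ vs f = foldr (λ v acc → f v ℤ.+ acc) (+ 0) vs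

δ : {V : Set} → (V → V → Bool) → V → V → ℤ
δ _≟V_ g h = if g ≟V h then + 1 else + 0

record IsDSRG {V : Set} (vs : List V) (_≟V_ : V → V → Bool)
              (A : V → V → ℤ) (N k μ λ′ t : ℕ) : Set where
  field
    order      : length vs ≡ N
    row-sums   : ∀ g → sumℤ vs (λ h → A g h) ≡ + k
    col-sums   : ∀ h → sumℤ vs (λ g → A g h) ≡ + k
    square     : ∀ g h →
      sumℤ vs (λ w → A g w ℤ.* A w h)
        ≡ (+ t) ℤ.* δ _≟V_ g h ℤ.+ (+ λ′) ℤ.* A g h
          ℤ.+ (+ μ) ℤ.* (+ 1 ℤ.- δ _≟V_ g h ℤ.- A g h)

_≟D_ : {n : ℕ} → D n → D n → Bool
_≟D_ (i , e) (j , f) = does (i F.≟ j) Data.Bool.∧ does (e Data.Bool.≟ f)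

-- Since agda-stdlib has no complex numbers, ℂ with complex conjugation
-- and a primitive n-th root of unity is axiomatised abstractly:
-- a field of characteristic 0, an involutive ring automorphism `conj`
-- (complex conjugation) and a primitive n-th root of unity ζ with
-- conj ζ = ζ^{-1} (as |ζ| = 1 in ℂ).

record CyclotomicSetting (c ℓ : Level) (n : ℕ) : Set (lsuc (c ⊔ ℓ)) where
  field
    R : CommutativeRing c ℓ
  open CommutativeRing R
  open RS (Semiring.rawSemiring semiring) using (_^_) renaming (_×_ to _×ᴿ_)
  open RingMorphisms rawRing rawRing using (IsRingHomomorphism)
  field
    1≉0       : ¬ (1# ≈ 0#)
    inverse   : ∀ x → ¬ (x ≈ 0#) → ∃ λ y → x * y ≈ 1#
    char-zero : ∀ m → ¬ ((suc m ×ᴿ 1#) ≈ 0#)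
    conj       : Carrier → Carrier
    conj-hom   : IsRingHomomorphism conj
    conj-invol : ∀ x → conj (conj x) ≈ x
    ζ         : Carrier
    ζ-root    : ζ ^ n ≈ 1#
    ζ-prim    : ∀ k → 0 < k → k < n → ¬ (ζ ^ k ≈ 1#)
    conj-ζ    : conj ζ * ζ ≈ 1#

module Cyclotomic {c ℓ : Level} {n : ℕ} (C : CyclotomicSetting c ℓ n) where
  open CyclotomicSetting C public
  open CommutativeRing R public
  open RS (Semiring.rawSemiring semiring) public using (_^_) renaming (_×_ to _×ᴿ_)

  ι : ℕ → Carrier
  ι m = m ×ᴿ 1#

  r : Subset n → Fin n → Carrier
  r X z = foldr (λ i acc → if does (i ∈? X) then ζ ^ (toℕ i ℕ.* toℕ z) + acc else acc)
                0# (allFin n)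

  δ0 : Fin n → Carrier
  δ0 z = if toℕ z ℕ.≡ᵇ 0 then 1# else 0#

-- Write χ for the indicator of X on Z_n.  The arc g → h of Dih(n,X,X) only depends on the index
-- d(g,h) ∈ Z_n of g⁻¹h, and so does the number of 2-walks: (A²)(g,h) = P(d(g,h)) with
-- P(z) = Σ_u χ(u) (χ(z - u) + χ(u - z)).  Every row and column sum is 2|X|.  As 0 ∉ X, the loop
-- at 1 and the pair (1, a) both have d = 0, so the square identity forces t = μ and reduces to
-- P = λ on X and P = μ off X.  Under the discrete Fourier transform f ↦ Σ_w f(w) ζ^{wz}, χ goes
-- to r, P to r (r + r̄) (the two convolutions give r and r̄) and the constant 1 to n δ_{z,0};
-- Fourier inversion in characteristic 0 makes the transform injective on ℕ-valued functions.

module Submission where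

open import Defs
open import Level using (Level)
open import Data.Nat using (ℕ; suc; _≤_) renaming (_*_ to _*ℕ_)
open import Data.Fin using (Fin; toℕ; zero)
open import Data.Fin.Subset using (Subset; _∈_; ∣_∣)
open import Data.Product using (_×_)
open import Function.Bundles using (_⇔_)
open import Relation.Binary.PropositionalEquality using (_≡_; _≢_)
open import Algebra.Bundles using (AbelianGroup; Group; CommutativeMonoid; CommutativeRing)
open import Data.Product.Function.NonDependent.Propositional using (_×-⇔_)
import Function.Properties.Equivalence as ⇔

module DivisionIdentities {a ℓ} (G : AbelianGroup a ℓ) where

  open AbelianGroup G
  open Group group using (_\\_; _//_)
  open import Algebra.Properties.AbelianGroup G
  open import Relation.Binary.Reasoning.Setoid setoid

  [x∙y]\\z≈y\\[x\\z] : ∀ x y z → (x ∙ y) \\ z ≈ y \\ (x \\ z)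
  [x∙y]\\z≈y\\[x\\z] x y z = begin
    (x ∙ y) ⁻¹ ∙ z      ≈⟨ ∙-congʳ (⁻¹-anti-homo-∙ x y) ⟩
    y ⁻¹ ∙ x ⁻¹ ∙ z     ≈⟨ assoc (y ⁻¹) (x ⁻¹) z ⟩
    y ⁻¹ ∙ (x ⁻¹ ∙ z)   ∎

  [x∙y]//z≈y//[x\\z] : ∀ x y z → (x ∙ y) // z ≈ y // (x \\ z)
  [x∙y]//z≈y//[x\\z] x y z = begin
    x ∙ y ∙ z ⁻¹        ≈⟨ ∙-congʳ (comm x y) ⟩
    y ∙ x ∙ z ⁻¹        ≈⟨ assoc y x (z ⁻¹) ⟩
    y ∙ (x ∙ z ⁻¹)      ≈⟨ ∙-congˡ (comm x (z ⁻¹)) ⟩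
    y ∙ (z ⁻¹ ∙ x)      ≈⟨ ∙-congˡ (⁻¹-anti-homo-\\ x z) ⟨
    y ∙ (x \\ z) ⁻¹    ∎

  [x//y]\\z≈y//[x//z] : ∀ x y z → (x // y) \\ z ≈ y // (x // z)
  [x//y]\\z≈y//[x//z] x y z = begin
    (x // y) ⁻¹ ∙ z     ≈⟨ ∙-congʳ (⁻¹-anti-homo-// x y) ⟩
    y ∙ x ⁻¹ ∙ z        ≈⟨ assoc y (x ⁻¹) z ⟩
    y ∙ (x ⁻¹ ∙ z)      ≈⟨ ∙-congˡ (comm (x ⁻¹) z) ⟩
    y ∙ (z ∙ x ⁻¹)      ≈⟨ ∙-congˡ (⁻¹-anti-homo-// x z) ⟨
    y ∙ (x // z) ⁻¹     ∎

  [x//y]//z≈y\\[x//z] : ∀ x y z → (x // y) // z ≈ y \\ (x // z)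
  [x//y]//z≈y\\[x//z] x y z = begin
    x ∙ y ⁻¹ ∙ z ⁻¹     ≈⟨ ∙-congʳ (comm x (y ⁻¹)) ⟩
    y ⁻¹ ∙ x ∙ z ⁻¹     ≈⟨ assoc (y ⁻¹) x (z ⁻¹) ⟩
    y ⁻¹ ∙ (x ∙ z ⁻¹)   ∎

  x//[x//y]≈y : ∀ x y → x // (x // y) ≈ y
  x//[x//y]≈y x y = begin
    x ∙ (x // y) ⁻¹     ≈⟨ ∙-congˡ (⁻¹-anti-homo-// x y) ⟩
    x ∙ (y // x)        ≈⟨ comm x (y // x) ⟩
    (y // x) ∙ x        ≈⟨ //-rightDividesˡ x y ⟩
    y                   ∎

module ZMod (m : ℕ) where

  open import Data.Nat as ℕ using (suc; _%_)
  open import Data.Nat.Properties using (+-comm; +-assoc; m∸n+n≡m; <⇒≤)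
  open import Data.Nat.DivMod using (_mod_; %-distribˡ-+; n%n≡0; m<n⇒m%n≡m)
  open import Data.Fin using (zero)
  open import Data.Fin.Properties using (toℕ-injective; toℕ-fromℕ<; toℕ<n)
  open import Data.Product using (_,_)
  open import Relation.Binary.PropositionalEquality
    using (trans; cong; cong₂; isEquivalence; module ≡-Reasoning)
  open ≡-Reasoning

  N : ℕ
  N = suc m

  [_] : ℕ → Fin N
  [ k ] = k mod N

  toℕ-[] : ∀ k → toℕ [ k ] ≡ k % N
  toℕ-[] k = toℕ-fromℕ< _

  [toℕ] : (a : Fin N) → [ toℕ a ] ≡ a
  [toℕ] a = toℕ-injective (trans (toℕ-[] (toℕ a)) (m<n⇒m%n≡m (toℕ<n a)))

  []-+ : ∀ k l → [ k ] +ₘ [ l ] ≡ [ k ℕ.+ l ]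
  []-+ k l = toℕ-injective (begin
    toℕ [ toℕ [ k ] ℕ.+ toℕ [ l ] ] ≡⟨ toℕ-[] (toℕ [ k ] ℕ.+ toℕ [ l ]) ⟩
    (toℕ [ k ] ℕ.+ toℕ [ l ]) % N   ≡⟨ cong₂ (λ x y → (x ℕ.+ y) % N) (toℕ-[] k) (toℕ-[] l) ⟩
    (k % N ℕ.+ l % N) % N           ≡⟨ %-distribˡ-+ k l N ⟨
    (k ℕ.+ l) % N                   ≡⟨ toℕ-[] (k ℕ.+ l) ⟨
    toℕ [ k ℕ.+ l ]                 ∎)

  -- Every law of Z_N is pulled back from ℕ along the surjective homomorphism [_].
  +ₘ-assoc : (a b c : Fin N) → (a +ₘ b) +ₘ c ≡ a +ₘ (b +ₘ c)
  +ₘ-assoc a b c = begin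
    [ x ℕ.+ y ] +ₘ c         ≡⟨ cong ([ x ℕ.+ y ] +ₘ_) ([toℕ] c) ⟨
    [ x ℕ.+ y ] +ₘ [ z ]     ≡⟨ []-+ (x ℕ.+ y) z ⟩
    [ x ℕ.+ y ℕ.+ z ]        ≡⟨ cong [_] (+-assoc x y z) ⟩
    [ x ℕ.+ (y ℕ.+ z) ]      ≡⟨ []-+ x (y ℕ.+ z) ⟨
    [ x ] +ₘ [ y ℕ.+ z ]     ≡⟨ cong (_+ₘ [ y ℕ.+ z ]) ([toℕ] a) ⟩
    a +ₘ (b +ₘ c)            ∎
    where
      x y z : ℕ
      x = toℕ a; y = toℕ b; z = toℕ c

  +ₘ-comm : (a b : Fin N) → a +ₘ b ≡ b +ₘ a
  +ₘ-comm a b = cong [_] (+-comm (toℕ a) (toℕ b))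

  +ₘ-identityˡ : (a : Fin N) → zero +ₘ a ≡ a
  +ₘ-identityˡ = [toℕ]

  -ₘ‿inverseˡ : (a : Fin N) → (-ₘ a) +ₘ a ≡ zero
  -ₘ‿inverseˡ a = begin
    [ N ℕ.∸ toℕ a ] +ₘ a          ≡⟨ cong ([ N ℕ.∸ toℕ a ] +ₘ_) ([toℕ] a) ⟨
    [ N ℕ.∸ toℕ a ] +ₘ [ toℕ a ]  ≡⟨ []-+ (N ℕ.∸ toℕ a) (toℕ a) ⟩
    [ N ℕ.∸ toℕ a ℕ.+ toℕ a ]     ≡⟨ cong [_] (m∸n+n≡m (<⇒≤ (toℕ<n a))) ⟩
    [ N ]                         ≡⟨ toℕ-injective (trans (toℕ-[] N) (n%n≡0 N)) ⟩
    zero                          ∎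

  +ₘ-abelianGroup : AbelianGroup _ _
  +ₘ-abelianGroup = record
    { Carrier = Fin N ; _≈_ = _≡_ ; _∙_ = _+ₘ_ ; ε = zero ; _⁻¹ = λ a → -ₘ a
    ; isAbelianGroup = record
      { isGroup = record
        { isMonoid = record
          { isSemigroup = record
            { isMagma = record { isEquivalence = isEquivalence ; ∙-cong = cong₂ _+ₘ_ }
            ; assoc = +ₘ-assoc }
          ; identity = +ₘ-identityˡ , λ a → trans (+ₘ-comm a zero) (+ₘ-identityˡ a) }
        ; inverse = -ₘ‿inverseˡ , λ a → trans (+ₘ-comm a (-ₘ a)) (-ₘ‿inverseˡ a)
        ; ⁻¹-cong = cong (λ a → -ₘ a) }
      ; comm = +ₘ-comm } }

  open AbelianGroup +ₘ-abelianGroup public using () renaming (_-_ to _//_)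
  open Group (AbelianGroup.group +ₘ-abelianGroup) public using (_\\_)
  open DivisionIdentities +ₘ-abelianGroup public
  open import Algebra.Properties.AbelianGroup +ₘ-abelianGroup public
    using (\\-leftDividesˡ; \\-leftDividesʳ; comm⇒\\≗flip-//; loop)
    renaming (x∙y⁻¹≈ε⇒x≈y to x//y≡ε⇒x≡y)
  open import Algebra.Properties.Loop loop public using (x\\x≈ε; x//x≈ε; ε\\x≈x)

module ∑-Reindexing (m : ℕ) {c ℓ} (M : CommutativeMonoid c ℓ) where

  open ZMod m
  open CommutativeMonoid M
  open import Algebra.Properties.CommutativeMonoid.Sum M using (sum; sum-permute; sum-cong-≗)
  open import Data.Fin.Permutation using (Permutation′; permutation)
  open import Relation.Binary.PropositionalEquality using (cong)

  ∑-\\ : ∀ a (F : Fin N → Fin N → Carrier) → sum (λ k → F (a \\ k) k) ≈ sum (λ u → F u (a +ₘ u))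
  ∑-\\ a F = trans (sum-permute (λ k → F (a \\ k) k) translation)
                    (reflexive (sum-cong-≗ (λ u → cong (λ x → F x (a +ₘ u)) (\\-leftDividesʳ a u))))
    where
      translation : Permutation′ N
      translation = permutation (a +ₘ_) (a \\_) (\\-leftDividesˡ a) (\\-leftDividesʳ a)

  ∑-// : ∀ a (F : Fin N → Fin N → Carrier) → sum (λ k → F (a // k) k) ≈ sum (λ u → F u (a // u))
  ∑-// a F = trans (sum-permute (λ k → F (a // k) k) reflection)
                  (reflexive (sum-cong-≗ (λ u → cong (λ x → F x (a // u)) (x//[x//y]≈y a u))))
    where
      reflection : Permutation′ N
      reflection = permutation (a //_) (a //_) (x//[x//y]≈y a) (x//[x//y]≈y a)

module ListSums where

  open import Data.Nat as ℕ using (zero; suc)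
  open import Data.Nat.Properties using (+-0-commutativeMonoid; +-identityʳ)
  open import Data.Integer as ℤ using (ℤ; +_)
  open import Data.Integer.Properties using (+-identityˡ; +-assoc)
  open import Data.List using (List; []; _∷_; _++_; map; tabulate; allFin; length)
  open import Function.Base using (id)
  open import Data.List.Properties using (map-tabulate; length-++; length-map; length-tabulate; foldr-cong)
  open import Data.Fin as F using (Fin)
  open import Data.Bool using (true; false)
  open import Data.Product using (_,_)
  open import Algebra.Properties.CommutativeMonoid.Sum +-0-commutativeMonoid using (sum)
  open import Relation.Binary.PropositionalEquality
  open ≡-Reasoning

  sumℤ-++ : {V : Set} (xs ys : List V) (f : V → ℤ) → sumℤ (xs ++ ys) f ≡ sumℤ xs f ℤ.+ sumℤ ys f
  sumℤ-++ [] ys f = sym (+-identityˡ (sumℤ ys f))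
  sumℤ-++ (x ∷ xs) ys f = trans (cong (λ s → f x ℤ.+ s) (sumℤ-++ xs ys f)) (sym (+-assoc (f x) _ _))

  sumℤ-cong : {V : Set} (xs : List V) {f g : V → ℤ} → (∀ v → f v ≡ g v) → sumℤ xs f ≡ sumℤ xs g
  sumℤ-cong xs f≗g = foldr-cong (λ v acc → cong (ℤ._+ acc) (f≗g v)) refl xs

  sumℤ-tabulate : {V : Set} {n : ℕ} (g : Fin n → V) (F : V → ℕ) →
                  sumℤ (tabulate g) (λ v → + F v) ≡ + sum (λ k → F (g k))
  sumℤ-tabulate {n = zero} g F = refl
  sumℤ-tabulate {n = suc n} g F =
    cong (λ s → + F (g F.zero) ℤ.+ s) (sumℤ-tabulate (λ k → g (F.suc k)) F)

  sumℤ-elemsD : {n : ℕ} (F : D n → ℕ) →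
                sumℤ (elemsD n) (λ w → + F w) ≡ + (sum (λ k → F (k , false)) ℕ.+ sum (λ k → F (k , true)))
  sumℤ-elemsD {n} F = begin
    sumℤ (map (_, false) (allFin n) ++ map (_, true) (allFin n)) (λ w → + F w)
      ≡⟨ sumℤ-++ (map (_, false) (allFin n)) (map (_, true) (allFin n)) (λ w → + F w) ⟩
    sumℤ (map (_, false) (allFin n)) (λ w → + F w) ℤ.+ sumℤ (map (_, true) (allFin n)) (λ w → + F w)
      ≡⟨ cong₂ (λ xs ys → sumℤ xs (λ w → + F w) ℤ.+ sumℤ ys (λ w → + F w))
               (map-tabulate id (_, false)) (map-tabulate id (_, true)) ⟩
    sumℤ (tabulate (_, false)) (λ w → + F w) ℤ.+ sumℤ (tabulate (_, true)) (λ w → + F w)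
      ≡⟨ cong₂ ℤ._+_ (sumℤ-tabulate (_, false) F) (sumℤ-tabulate (_, true) F) ⟩
    + (sum (λ k → F (k , false)) ℕ.+ sum (λ k → F (k , true))) ∎

  length-elemsD : (n : ℕ) → length (elemsD n) ≡ 2 *ℕ n
  length-elemsD n = begin
    length (map (_, false) (allFin n) ++ map (_, true) (allFin n))
      ≡⟨ length-++ (map (_, false) (allFin n)) ⟩
    length (map (_, false) (allFin n)) ℕ.+ length (map (_, true) (allFin n))
      ≡⟨ cong₂ ℕ._+_ (trans (length-map _ (allFin n)) (length-tabulate (id {A = Fin n})))
                     (trans (length-map _ (allFin n)) (length-tabulate (id {A = Fin n}))) ⟩
    n ℕ.+ n
      ≡⟨ cong (n ℕ.+_) (+-identityʳ n) ⟨
    2 *ℕ n ∎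

module Indicator where

  open import Data.Nat using (suc)
  open import Data.Nat.Properties using (+-0-commutativeMonoid)
  open import Data.Bool using (if_then_else_)
  open import Data.Vec using ([]; _∷_)
  open import Data.Fin.Subset using (inside; outside)
  open import Data.Fin.Subset.Properties using (_∈?_)
  open import Relation.Nullary using (does)
  open import Relation.Binary.PropositionalEquality using (refl; cong)
  open import Algebra.Properties.CommutativeMonoid.Sum +-0-commutativeMonoid using (sum)

  indicator : {n : ℕ} → Subset n → Fin n → ℕ
  indicator X i = if does (i ∈? X) then 1 else 0

  ∑-indicator : {n : ℕ} (X : Subset n) → sum (indicator X) ≡ ∣ X ∣
  ∑-indicator [] = refl
  ∑-indicator (inside ∷ X) = cong suc (∑-indicator X)
  ∑-indicator (outside ∷ X) = ∑-indicator X

module SquareEquation where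

  open import Data.Integer as ℤ using (ℤ; +_)
  open import Data.Integer.Properties using (*-identityʳ; *-zeroʳ)
  open import Data.Nat.Properties using (+-identityʳ)
  open import Relation.Binary.PropositionalEquality using (refl; trans; cong)

  squareRHS : ℕ → ℕ → ℕ → ℤ → ℤ → ℤ
  squareRHS t λ′ μ δ a = + t ℤ.* δ ℤ.+ + λ′ ℤ.* a ℤ.+ + μ ℤ.* (+ 1 ℤ.- δ ℤ.- a)

  squareRHS-diagonal : ∀ t λ′ μ → squareRHS t λ′ μ (+ 1) (+ 0) ≡ + t
  squareRHS-diagonal t λ′ μ rewrite *-identityʳ (+ t) | *-zeroʳ (+ λ′) | *-zeroʳ (+ μ) =
    cong +_ (trans (+-identityʳ _) (+-identityʳ t))

  squareRHS-arc : ∀ t λ′ μ → squareRHS t λ′ μ (+ 0) (+ 1) ≡ + λ′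
  squareRHS-arc t λ′ μ rewrite *-zeroʳ (+ t) | *-identityʳ (+ λ′) | *-zeroʳ (+ μ) =
    cong +_ (+-identityʳ λ′)

  squareRHS-nonArc : ∀ t λ′ μ → squareRHS t λ′ μ (+ 0) (+ 0) ≡ + μ
  squareRHS-nonArc t λ′ μ rewrite *-zeroʳ (+ t) | *-zeroʳ (+ λ′) | *-identityʳ (+ μ) = refl

module DihedralCayley (m : ℕ) (X : Subset (suc m)) where

  open ZMod m
  open Indicator
  open ListSums
  open SquareEquation
  open import Data.Nat as ℕ using (suc)
  open import Data.Nat.Properties using (+-0-commutativeMonoid; +-comm; *-distribˡ-+; +-identityʳ)
  open import Data.Integer as ℤ using (ℤ; +_)
  open import Data.Integer.Properties using (pos-*; +-injective)
  open import Data.Bool as Bool using (Bool; true; false; if_then_else_)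
  open import Data.Fin as F using (zero)
  open import Data.Fin.Subset using (_∉_)
  open import Data.Fin.Subset.Properties using (_∈?_)
  open import Data.Product using (_,_)
  open import Data.Sum using (_⊎_; inj₁; inj₂)
  open import Data.Empty using (⊥-elim)
  open import Relation.Nullary using (does; yes; no)
  open import Relation.Binary.PropositionalEquality
  open import Function.Bundles using (mk⇔; Equivalence)
  open import Algebra.Properties.CommutativeMonoid.Sum +-0-commutativeMonoid
    using (sum; sum-cong-≗; ∑-distrib-+)
  open ∑-Reindexing m +-0-commutativeMonoid
  open ≡-Reasoning

  χ : Fin N → ℕ
  χ = indicator X

  -- The index in Z_N of g⁻¹h, on which Dih N X X g h depends.
  d : D N → D N → Fin N
  d (i , false) (j , _) = i \\ j
  d (i , true)  (j , _) = i // j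

  if-+ : ∀ b → (if b then + 1 else + 0) ≡ + (if b then 1 else 0)
  if-+ true = refl
  if-+ false = refl

  Dih≡χ∘d : ∀ g h → Dih N X X g h ≡ + χ (d g h)
  Dih≡χ∘d (i , false) (j , false) = if-+ _
  Dih≡χ∘d (i , false) (j , true)  = if-+ _
  Dih≡χ∘d (i , true)  (j , false) = if-+ _
  Dih≡χ∘d (i , true)  (j , true)  = if-+ _

  d-diagonal : ∀ g → d g g ≡ zero
  d-diagonal (i , false) = x\\x≈ε i
  d-diagonal (i , true)  = x//x≈ε i

  δ-cases : ∀ (g h : D N) → (g ≡ h × δ _≟D_ g h ≡ + 1) ⊎ δ _≟D_ g h ≡ + 0
  δ-cases (i , e) (j , f) with i F.≟ j | e Bool.≟ f
  ... | yes refl | yes refl = inj₁ (refl , refl)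
  ... | yes _    | no _     = inj₂ refl
  ... | no _     | _        = inj₂ refl

  δ-false-true : ∀ (i j : Fin N) → δ _≟D_ (i , false) (j , true) ≡ + 0
  δ-false-true i j with does (i F.≟ j)
  ... | true  = refl
  ... | false = refl

  ∑χ∘\\ : ∀ i → sum (λ k → χ (i \\ k)) ≡ ∣ X ∣
  ∑χ∘\\ i = trans (∑-\\ i (λ u _ → χ u)) (∑-indicator X)

  ∑χ∘// : ∀ i → sum (λ k → χ (i // k)) ≡ ∣ X ∣
  ∑χ∘// i = trans (∑-// i (λ u _ → χ u)) (∑-indicator X)

  outDegree : ∀ g e → sum (λ k → χ (d g (k , e))) ≡ ∣ X ∣
  outDegree (i , false) e = ∑χ∘\\ i
  outDegree (i , true)  e = ∑χ∘// i

  inDegree : ∀ h e → sum (λ k → χ (d (k , e) h)) ≡ ∣ X ∣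
  inDegree (j , f) false = trans (sum-cong-≗ (λ k → cong χ (comm⇒\\≗flip-// +ₘ-comm k j))) (∑χ∘// j)
  inDegree (j , f) true  = trans (sum-cong-≗ (λ k → cong χ (sym (comm⇒\\≗flip-// +ₘ-comm j k)))) (∑χ∘\\ j)

  sumℤ-regular : (F : D N → ℕ) → (∀ e → sum (λ k → F (k , e)) ≡ ∣ X ∣) →
                 sumℤ (elemsD N) (λ w → + F w) ≡ + (2 *ℕ ∣ X ∣)
  sumℤ-regular F degree = trans (sumℤ-elemsD F) (cong +_ (begin
    sum (λ k → F (k , false)) ℕ.+ sum (λ k → F (k , true))   ≡⟨ cong₂ ℕ._+_ (degree false) (degree true) ⟩
    ∣ X ∣ ℕ.+ ∣ X ∣                                           ≡⟨ cong (∣ X ∣ ℕ.+_) (+-identityʳ ∣ X ∣) ⟨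
    2 *ℕ ∣ X ∣                                                ∎))

  sumℤ-Dih-row : ∀ g → sumℤ (elemsD N) (λ h → Dih N X X g h) ≡ + (2 *ℕ ∣ X ∣)
  sumℤ-Dih-row g = trans (sumℤ-cong (elemsD N) (Dih≡χ∘d g)) (sumℤ-regular (λ h → χ (d g h)) (outDegree g))

  sumℤ-Dih-column : ∀ h → sumℤ (elemsD N) (λ g → Dih N X X g h) ≡ + (2 *ℕ ∣ X ∣)
  sumℤ-Dih-column h = trans (sumℤ-cong (elemsD N) (λ g → Dih≡χ∘d g h)) (sumℤ-regular (λ g → χ (d g h)) (inDegree h))

  -- (A²)(1, x^z a^f), for either f.
  twoWalks : Fin N → ℕ
  twoWalks z = sum (λ u → χ u ℕ.* (χ (u \\ z) ℕ.+ χ (u // z)))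

  twoWalks-split : ∀ z → sum (λ u → χ u ℕ.* χ (u \\ z)) ℕ.+ sum (λ u → χ u ℕ.* χ (u // z)) ≡ twoWalks z
  twoWalks-split z = trans (sym (∑-distrib-+ (λ u → χ u ℕ.* χ (u \\ z)) (λ u → χ u ℕ.* χ (u // z))))
                           (sum-cong-≗ (λ u → sym (*-distribˡ-+ (χ u) (χ (u \\ z)) (χ (u // z)))))

  walks : D N → D N → ℕ
  walks g h = sum (λ k → χ (d g (k , false)) ℕ.* χ (d (k , false) h))
              ℕ.+ sum (λ k → χ (d g (k , true)) ℕ.* χ (d (k , true) h))

  walks≡twoWalks∘d : ∀ g h → walks g h ≡ twoWalks (d g h)
  walks≡twoWalks∘d (i , false) (j , f) = trans (cong₂ ℕ._+_
      (trans (∑-\\ i (λ u k → χ u ℕ.* χ (k \\ j)))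
             (sum-cong-≗ (λ u → cong (λ x → χ u ℕ.* χ x) ([x∙y]\\z≈y\\[x\\z] i u j))))
      (trans (∑-\\ i (λ u k → χ u ℕ.* χ (k // j)))
             (sum-cong-≗ (λ u → cong (λ x → χ u ℕ.* χ x) ([x∙y]//z≈y//[x\\z] i u j)))))
    (twoWalks-split (i \\ j))
  walks≡twoWalks∘d (i , true) (j , f) = trans (trans (cong₂ ℕ._+_
      (trans (∑-// i (λ u k → χ u ℕ.* χ (k \\ j)))
             (sum-cong-≗ (λ u → cong (λ x → χ u ℕ.* χ x) ([x//y]\\z≈y//[x//z] i u j))))
      (trans (∑-// i (λ u k → χ u ℕ.* χ (k // j)))
             (sum-cong-≗ (λ u → cong (λ x → χ u ℕ.* χ x) ([x//y]//z≈y\\[x//z] i u j)))))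
    (+-comm (sum (λ u → χ u ℕ.* χ (u // (i // j)))) _)) (twoWalks-split (i // j))

  Dih²≡twoWalks∘d : ∀ g h → sumℤ (elemsD N) (λ w → Dih N X X g w ℤ.* Dih N X X w h) ≡ + twoWalks (d g h)
  Dih²≡twoWalks∘d g h = begin
    sumℤ (elemsD N) (λ w → Dih N X X g w ℤ.* Dih N X X w h)
      ≡⟨ sumℤ-cong (elemsD N) (λ w → trans (cong₂ ℤ._*_ (Dih≡χ∘d g w) (Dih≡χ∘d w h)) (sym (pos-* (χ (d g w)) (χ (d w h))))) ⟩
    sumℤ (elemsD N) (λ w → + (χ (d g w) ℕ.* χ (d w h)))
      ≡⟨ sumℤ-elemsD (λ w → χ (d g w) ℕ.* χ (d w h)) ⟩
    + walks g h
      ≡⟨ cong +_ (walks≡twoWalks∘d g h) ⟩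
    + twoWalks (d g h) ∎

  prescribed : ℕ → ℕ → Fin N → ℕ
  prescribed λ′ μ z = if does (z ∈? X) then λ′ else μ

  module _ (μ λ′ t : ℕ) where

    squareRHS-offDiagonal : ∀ z → squareRHS t λ′ μ (+ 0) (+ χ z) ≡ + prescribed λ′ μ z
    squareRHS-offDiagonal z with does (z ∈? X)
    ... | true  = squareRHS-arc t λ′ μ
    ... | false = squareRHS-nonArc t λ′ μ

    WalkEquation : D N → D N → Set
    WalkEquation g h = + twoWalks (d g h) ≡ squareRHS t λ′ μ (δ _≟D_ g h) (+ χ (d g h))

    module _ (0∉X : zero ∉ X) where

      χ-zero : χ zero ≡ 0
      χ-zero with zero ∈? X
      ... | yes 0∈X = ⊥-elim (0∉X 0∈X)
      ... | no _    = refl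

      prescribed-zero : prescribed λ′ μ zero ≡ μ
      prescribed-zero with zero ∈? X
      ... | yes 0∈X = ⊥-elim (0∉X 0∈X)
      ... | no _    = refl

      walkEquation⇒ : (∀ g h → WalkEquation g h) → t ≡ μ × (∀ z → twoWalks z ≡ prescribed λ′ μ z)
      walkEquation⇒ walkEq = t≡μ , twoWalks≡prescribed
        where
          twoWalks≡prescribed : ∀ z → twoWalks z ≡ prescribed λ′ μ z
          twoWalks≡prescribed z = +-injective (begin
            + twoWalks z                              ≡⟨ cong (λ x → + twoWalks x) (ε\\x≈x z) ⟨
            + twoWalks (zero \\ z)                   ≡⟨ walkEq (zero , false) (z , true) ⟩
            squareRHS t λ′ μ (δ _≟D_ (zero , false) (z , true)) (+ χ (zero \\ z))
              ≡⟨ cong₂ (squareRHS t λ′ μ) (δ-false-true zero z) (cong (λ x → + χ x) (ε\\x≈x z)) ⟩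
            squareRHS t λ′ μ (+ 0) (+ χ z)            ≡⟨ squareRHS-offDiagonal z ⟩
            + prescribed λ′ μ z                       ∎)
          t≡μ : t ≡ μ
          t≡μ = +-injective (begin
            + t                                           ≡⟨ squareRHS-diagonal t λ′ μ ⟨
            squareRHS t λ′ μ (+ 1) (+ 0)                  ≡⟨ cong (λ x → squareRHS t λ′ μ (+ 1) (+ x)) χ-zero ⟨
            squareRHS t λ′ μ (+ 1) (+ χ zero)             ≡⟨ cong (λ x → squareRHS t λ′ μ (+ 1) (+ χ x)) (x\\x≈ε zero) ⟨
            squareRHS t λ′ μ (+ 1) (+ χ (zero \\ zero))  ≡⟨ walkEq (zero , false) (zero , false) ⟨
            + twoWalks (zero \\ zero)                    ≡⟨ cong (λ x → + twoWalks x) (x\\x≈ε zero) ⟩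
            + twoWalks zero                               ≡⟨ cong +_ (twoWalks≡prescribed zero) ⟩
            + prescribed λ′ μ zero                        ≡⟨ cong +_ prescribed-zero ⟩
            + μ                                           ∎)

      walkEquation⇐ : t ≡ μ → (∀ z → twoWalks z ≡ prescribed λ′ μ z) → ∀ g h → WalkEquation g h
      walkEquation⇐ t≡μ twoWalks≡prescribed g h with δ-cases g h
      ... | inj₂ δ≡0 = begin
        + twoWalks (d g h)                           ≡⟨ cong +_ (twoWalks≡prescribed (d g h)) ⟩
        + prescribed λ′ μ (d g h)                    ≡⟨ squareRHS-offDiagonal (d g h) ⟨
        squareRHS t λ′ μ (+ 0) (+ χ (d g h))         ≡⟨ cong (λ δ → squareRHS t λ′ μ δ (+ χ (d g h))) δ≡0 ⟨
        squareRHS t λ′ μ (δ _≟D_ g h) (+ χ (d g h))  ∎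
      ... | inj₁ (refl , δ≡1) = begin
        + twoWalks (d g g)                           ≡⟨ cong (λ x → + twoWalks x) (d-diagonal g) ⟩
        + twoWalks zero                              ≡⟨ cong +_ (trans (twoWalks≡prescribed zero) (trans prescribed-zero (sym t≡μ))) ⟩
        + t                                          ≡⟨ squareRHS-diagonal t λ′ μ ⟨
        squareRHS t λ′ μ (+ 1) (+ 0)                 ≡⟨ cong₂ (squareRHS t λ′ μ) δ≡1 (cong +_ (trans (cong χ (d-diagonal g)) χ-zero)) ⟨
        squareRHS t λ′ μ (δ _≟D_ g g) (+ χ (d g g))  ∎

      SquareIdentity : D N → D N → Set
      SquareIdentity g h = sumℤ (elemsD N) (λ w → Dih N X X g w ℤ.* Dih N X X w h)
                             ≡ squareRHS t λ′ μ (δ _≟D_ g h) (Dih N X X g h)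

      square⇔walk : ∀ g h → SquareIdentity g h ⇔ WalkEquation g h
      square⇔walk g h = mk⇔
        (λ sq → trans (sym (Dih²≡twoWalks∘d g h)) (trans sq (cong (squareRHS t λ′ μ (δ _≟D_ g h)) (Dih≡χ∘d g h))))
        (λ we → trans (Dih²≡twoWalks∘d g h) (trans we (sym (cong (squareRHS t λ′ μ (δ _≟D_ g h)) (Dih≡χ∘d g h)))))

      isDSRG⇔ : IsDSRG (elemsD N) _≟D_ (Dih N X X) (2 *ℕ N) (2 *ℕ ∣ X ∣) μ λ′ t
                  ⇔ (t ≡ μ × (∀ z → twoWalks z ≡ prescribed λ′ μ z))
      isDSRG⇔ = mk⇔
        (λ G → walkEquation⇒ (λ g h → Equivalence.to (square⇔walk g h) (IsDSRG.square G g h)))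
        (λ (t≡μ , twoWalks≡prescribed) → record
          { order    = length-elemsD N
          ; row-sums = sumℤ-Dih-row
          ; col-sums = sumℤ-Dih-column
          ; square   = λ g h → Equivalence.from (square⇔walk g h) (walkEquation⇐ t≡μ twoWalks≡prescribed g h) })

module CommutativeRingPowers {c ℓ} (R : CommutativeRing c ℓ) where

  open CommutativeRing R
  open import Data.Nat as ℕ using (zero; suc; _%_; _/_; NonZero)
  open import Data.Nat.Properties using () renaming (*-comm to *ℕ-comm)
  open import Data.Nat.DivMod using (m≡m%n+[m/n]*n)
  open import Relation.Binary.PropositionalEquality as ≡ using ()
  open import Algebra.Properties.Semiring.Exp semiring using (_^_; ^-homo-*; ^-assocʳ; ^-congˡ)
  open import Relation.Binary.Reasoning.Setoid setoid

  1#^≈1# : ∀ k → 1# ^ k ≈ 1#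
  1#^≈1# zero    = refl
  1#^≈1# (suc k) = trans (*-identityˡ (1# ^ k)) (1#^≈1# k)

  ^-% : ∀ n .{{_ : NonZero n}} {x} → x ^ n ≈ 1# → ∀ k → x ^ (k % n) ≈ x ^ k
  ^-% n {x} x^n≈1 k = begin
    x ^ (k % n)                           ≈⟨ *-identityʳ (x ^ (k % n)) ⟨
    x ^ (k % n) * 1#                      ≈⟨ *-congˡ (trans (^-congˡ (k / n) x^n≈1) (1#^≈1# (k / n))) ⟨
    x ^ (k % n) * (x ^ n) ^ (k / n)       ≈⟨ *-congˡ (^-assocʳ x n (k / n)) ⟩
    x ^ (k % n) * x ^ (n ℕ.* (k / n))     ≈⟨ ^-homo-* x (k % n) (n ℕ.* (k / n)) ⟨
    x ^ (k % n ℕ.+ n ℕ.* (k / n))         ≡⟨ ≡.cong (λ j → x ^ (k % n ℕ.+ j)) (*ℕ-comm n (k / n)) ⟩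
    x ^ (k % n ℕ.+ k / n ℕ.* n)           ≡⟨ ≡.cong (x ^_) (m≡m%n+[m/n]*n k n) ⟨
    x ^ k                                 ∎

  *-inverse-unique : ∀ x x′ y → x * y ≈ 1# → x′ * y ≈ 1# → x ≈ x′
  *-inverse-unique x x′ y xy≈1 x′y≈1 = begin
    x               ≈⟨ *-identityʳ x ⟨
    x * 1#          ≈⟨ *-congˡ x′y≈1 ⟨
    x * (x′ * y)    ≈⟨ *-congˡ (*-comm x′ y) ⟩
    x * (y * x′)    ≈⟨ *-assoc x y x′ ⟨
    x * y * x′      ≈⟨ *-congʳ xy≈1 ⟩
    1# * x′         ≈⟨ *-identityˡ x′ ⟩
    x′              ∎

module Fourier {c ℓ} (m : ℕ) (C : CyclotomicSetting c ℓ (suc m)) where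

  open ZMod m
  open Cyclotomic C
  open CommutativeRingPowers R
  open import Data.Nat as ℕ using (zero; suc; _%_)
  import Data.Nat.Properties as ℕₚ
  open import Data.Fin as F using ()
  open import Data.Fin.Properties using (toℕ<n; toℕ-inject₁; toℕ-fromℕ; punchInᵢ≢i)
  open import Data.Empty using (⊥-elim)
  open import Relation.Nullary using (¬_)
  open import Relation.Binary.PropositionalEquality as ≡ using ()
  open import Function.Bundles using (mk⇔)
  open import Algebra.Morphism.Structures using (module RingMorphisms)
  open import Algebra.Properties.Monoid.Mult +-monoid using (×-homo-+)
  open import Algebra.Properties.Semiring.Mult semiring using (×1-homo-*)
  open import Algebra.Properties.Semiring.Exp semiring using (^-homo-*; ^-assocʳ; ^-congˡ)
  open import Algebra.Properties.CommutativeSemiring.Exp commutativeSemiring using (^-distrib-*)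
  open import Algebra.Properties.AbelianGroup +-abelianGroup using (∙-cancelˡ; x∙y⁻¹≈ε⇒x≈y)
  open import Algebra.Properties.Ring ring using (-‿distribˡ-*)
  open import Algebra.Properties.Semiring.Sum semiring
    using (sum; sum-cong-≗; sum-cong-≋; sum-init-last; sum-replicate; sum-remove; sum-replicate-zero; ∑-comm; ∑-distrib-+; *-distribˡ-sum; *-distribʳ-sum)
  open import Data.Product using (_,_)
  open import Relation.Binary.Reasoning.Setoid setoid

  module conj = RingMorphisms.IsRingHomomorphism conj-hom

  ι-+ : ∀ a b → ι (a ℕ.+ b) ≈ ι a + ι b
  ι-+ = ×-homo-+ 1#

  ι-* : ∀ a b → ι (a ℕ.* b) ≈ ι a * ι b
  ι-* = ×1-homo-*

  -- ι (suc a) unfolds to 1# + ι a.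
  ι-injective : ∀ a b → ι a ≈ ι b → a ≡ b
  ι-injective zero    zero    _ = ≡.refl
  ι-injective zero    (suc b) p = ⊥-elim (char-zero b (sym p))
  ι-injective (suc a) zero    p = ⊥-elim (char-zero a p)
  ι-injective (suc a) (suc b) p = ≡.cong suc (ι-injective a b (∙-cancelˡ 1# (ι a) (ι b) p))

  conj-ι : ∀ a → conj (ι a) ≈ ι a
  conj-ι zero    = conj.0#-homo
  conj-ι (suc a) = trans (conj.+-homo 1# (ι a)) (+-cong conj.1#-homo (conj-ι a))

  ζ^^N≈1 : ∀ a → (ζ ^ a) ^ N ≈ 1#
  ζ^^N≈1 a = begin
    (ζ ^ a) ^ N     ≈⟨ ^-assocʳ ζ a N ⟩
    ζ ^ (a ℕ.* N)   ≡⟨ ≡.cong (ζ ^_) (ℕₚ.*-comm a N) ⟩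
    ζ ^ (N ℕ.* a)   ≈⟨ ^-assocʳ ζ N a ⟨
    (ζ ^ N) ^ a     ≈⟨ trans (^-congˡ a ζ-root) (1#^≈1# a) ⟩
    1#              ∎

  *-fixed⇒≈0 : ∀ {x s} → x * s ≈ s → ¬ x ≈ 1# → s ≈ 0#
  *-fixed⇒≈0 {x} {s} xs≈s x≉1 with inverse (x - 1#) (λ x-1≈0 → x≉1 (x∙y⁻¹≈ε⇒x≈y x 1# x-1≈0))
  ... | y , [x-1]y≈1 = begin
    s                     ≈⟨ *-identityˡ s ⟨
    1# * s                ≈⟨ *-congʳ (trans (*-comm y (x - 1#)) [x-1]y≈1) ⟨
    y * (x - 1#) * s      ≈⟨ *-assoc y (x - 1#) s ⟩
    y * ((x - 1#) * s)    ≈⟨ *-congˡ [x-1]s≈0 ⟩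
    y * 0#                ≈⟨ zeroʳ y ⟩
    0#                    ∎
    where
      [x-1]s≈0 : (x - 1#) * s ≈ 0#
      [x-1]s≈0 = begin
        (x - 1#) * s        ≈⟨ distribʳ s x (- 1#) ⟩
        x * s + - 1# * s    ≈⟨ +-cong xs≈s (trans (sym (-‿distribˡ-* 1# s)) (-‿cong (*-identityˡ s))) ⟩
        s - s               ≈⟨ -‿inverseʳ s ⟩
        0#                  ∎

  ∑-powers≈0 : ∀ {x} → x ^ N ≈ 1# → ¬ x ≈ 1# → sum (λ (w : Fin N) → x ^ toℕ w) ≈ 0#
  ∑-powers≈0 {x} x^N≈1 x≉1 = *-fixed⇒≈0 x*S≈S x≉1
    where
      T : Carrier
      T = sum (λ (w : Fin m) → x ^ suc (toℕ w))
      x*S≈S : x * sum (λ (w : Fin N) → x ^ toℕ w) ≈ sum (λ (w : Fin N) → x ^ toℕ w)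
      x*S≈S = begin
        x * sum (λ (w : Fin N) → x ^ toℕ w)
          ≈⟨ *-distribˡ-sum {N} x (λ w → x ^ toℕ w) ⟩
        sum (λ (w : Fin N) → x ^ suc (toℕ w))
          ≈⟨ sum-init-last {m} (λ w → x ^ suc (toℕ w)) ⟩
        sum (λ (w : Fin m) → x ^ suc (toℕ (F.inject₁ w))) + x ^ suc (toℕ (F.fromℕ m))
          ≡⟨ ≡.cong₂ (λ s k → s + x ^ suc k) (sum-cong-≗ {m} (λ w → ≡.cong (λ k → x ^ suc k) (toℕ-inject₁ w))) (toℕ-fromℕ m) ⟩
        T + x ^ N
          ≈⟨ +-congˡ x^N≈1 ⟩
        T + 1#
          ≈⟨ +-comm T 1# ⟩
        sum (λ (w : Fin N) → x ^ toℕ w) ∎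

  e : Fin N → Fin N → Carrier
  e w z = ζ ^ (toℕ w ℕ.* toℕ z)

  e-comm : ∀ w z → e w z ≡ e z w
  e-comm w z = ≡.cong (ζ ^_) (ℕₚ.*-comm (toℕ w) (toℕ z))

  e≈ζ^^ : ∀ w z → e w z ≈ (ζ ^ toℕ z) ^ toℕ w
  e≈ζ^^ w z = trans (reflexive (e-comm w z)) (sym (^-assocʳ ζ (toℕ z) (toℕ w)))

  e-+ₘ : ∀ a b z → e (a +ₘ b) z ≈ e a z * e b z
  e-+ₘ a b z = begin
    e (a +ₘ b) z                  ≈⟨ e≈ζ^^ (a +ₘ b) z ⟩
    q ^ toℕ (a +ₘ b)              ≡⟨ ≡.cong (q ^_) (toℕ-[] (toℕ a ℕ.+ toℕ b)) ⟩
    q ^ ((toℕ a ℕ.+ toℕ b) % N)   ≈⟨ ^-% N (ζ^^N≈1 (toℕ z)) (toℕ a ℕ.+ toℕ b) ⟩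
    q ^ (toℕ a ℕ.+ toℕ b)         ≈⟨ ^-homo-* q (toℕ a) (toℕ b) ⟩
    q ^ toℕ a * q ^ toℕ b         ≈⟨ *-cong (e≈ζ^^ a z) (e≈ζ^^ b z) ⟨
    e a z * e b z                 ∎
    where
      q : Carrier
      q = ζ ^ toℕ z

  conj-^ : ∀ x k → conj (x ^ k) ≈ conj x ^ k
  conj-^ x zero    = conj.1#-homo
  conj-^ x (suc k) = trans (conj.*-homo x (x ^ k)) (*-congˡ (conj-^ x k))

  conj-e : ∀ a z → conj (e a z) ≈ e (-ₘ a) z
  conj-e a z = *-inverse-unique (conj (e a z)) (e (-ₘ a) z) (e a z) conj[e]*e≈1 e[-a]*e≈1
    where
      k : ℕ
      k = toℕ a ℕ.* toℕ z
      conj[e]*e≈1 : conj (e a z) * e a z ≈ 1#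
      conj[e]*e≈1 = begin
        conj (ζ ^ k) * ζ ^ k    ≈⟨ *-congʳ (conj-^ ζ k) ⟩
        conj ζ ^ k * ζ ^ k      ≈⟨ ^-distrib-* (conj ζ) ζ k ⟨
        (conj ζ * ζ) ^ k        ≈⟨ ^-congˡ k conj-ζ ⟩
        1# ^ k                  ≈⟨ 1#^≈1# k ⟩
        1#                      ∎
      e[-a]*e≈1 : e (-ₘ a) z * e a z ≈ 1#
      e[-a]*e≈1 = trans (sym (e-+ₘ (-ₘ a) a z)) (reflexive (≡.cong (λ b → e b z) (-ₘ‿inverseˡ a)))

  e-// : ∀ a b z → e (a // b) z ≈ e a z * conj (e b z)
  e-// a b z = trans (e-+ₘ a (-ₘ b) z) (*-congˡ (sym (conj-e b z)))

  orthogonality : ∀ z → sum (λ w → e z w) ≈ ι N * δ0 z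
  orthogonality F.zero = begin
    sum (λ (_ : Fin N) → 1#)   ≈⟨ sum-replicate N ⟩
    ι N                        ≈⟨ *-identityʳ (ι N) ⟨
    ι N * 1#                   ∎
  orthogonality z@(F.suc _) = begin
    sum (λ w → e z w)                         ≈⟨ sum-cong-≋ {N} (λ w → trans (reflexive (e-comm z w)) (e≈ζ^^ w z)) ⟩
    sum (λ (w : Fin N) → (ζ ^ toℕ z) ^ toℕ w) ≈⟨ ∑-powers≈0 (ζ^^N≈1 (toℕ z)) (ζ-prim (toℕ z) (ℕ.s≤s ℕ.z≤n) (toℕ<n z)) ⟩
    0#                                        ≈⟨ zeroʳ (ι N) ⟨
    ι N * 0#                                  ∎

  δ0-≢zero : ∀ {w} → w ≢ F.zero → δ0 w ≡ 0#
  δ0-≢zero {F.zero}  w≢0 = ⊥-elim (w≢0 ≡.refl)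
  δ0-≢zero {F.suc _} _   = ≡.refl

  ∑-sift : ∀ j (f : Fin N → Carrier) → sum (λ w → f w * δ0 (w // j)) ≈ f j
  ∑-sift j f = begin
    sum (λ w → f w * δ0 (w // j))                                  ≈⟨ sum-remove {i = j} (λ w → f w * δ0 (w // j)) ⟩
    f j * δ0 (j // j) + sum (λ k → f (F.punchIn j k) * δ0 (F.punchIn j k // j))
      ≈⟨ +-cong (*-congˡ (reflexive (≡.cong δ0 (x//x≈ε j)))) (sum-cong-≋ {m} (λ k → others k)) ⟩
    f j * 1# + sum (λ (_ : Fin m) → 0#)                             ≈⟨ +-cong (*-identityʳ (f j)) (sum-replicate-zero m) ⟩
    f j + 0#                                                       ≈⟨ +-identityʳ (f j) ⟩
    f j                                                            ∎
    where
      others : ∀ k → f (F.punchIn j k) * δ0 (F.punchIn j k // j) ≈ 0#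
      others k = trans (*-congˡ (reflexive (δ0-≢zero (λ eq → punchInᵢ≢i j k (x//y≡ε⇒x≡y (F.punchIn j k) j eq)))))
                       (zeroʳ (f (F.punchIn j k)))

  FT : (Fin N → ℕ) → Fin N → Carrier
  FT f z = sum (λ w → ι (f w) * e w z)

  FT-inversion : ∀ f j → sum (λ z → FT f z * conj (e j z)) ≈ ι (f j) * ι N
  FT-inversion f j = begin
    sum (λ z → FT f z * conj (e j z))
      ≈⟨ sum-cong-≋ {N} (λ z → *-distribʳ-sum (conj (e j z)) (λ w → ι (f w) * e w z)) ⟩
    sum (λ z → sum (λ w → ι (f w) * e w z * conj (e j z)))
      ≈⟨ ∑-comm (λ z w → ι (f w) * e w z * conj (e j z)) ⟩
    sum (λ w → sum (λ z → ι (f w) * e w z * conj (e j z)))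
      ≈⟨ sum-cong-≋ {N} (λ w → sum-cong-≋ {N} (λ z → trans (*-assoc (ι (f w)) (e w z) _) (*-congˡ (sym (e-// w j z))))) ⟩
    sum (λ w → sum (λ z → ι (f w) * e (w // j) z))
      ≈⟨ sum-cong-≋ {N} (λ w → sym (*-distribˡ-sum (ι (f w)) (λ z → e (w // j) z))) ⟩
    sum (λ w → ι (f w) * sum (λ z → e (w // j) z))
      ≈⟨ sum-cong-≋ {N} (λ w → *-congˡ {ι (f w)} (orthogonality (w // j))) ⟩
    sum (λ w → ι (f w) * (ι N * δ0 (w // j)))
      ≈⟨ sum-cong-≋ {N} (λ w → sym (*-assoc (ι (f w)) (ι N) (δ0 (w // j)))) ⟩
    sum (λ w → ι (f w) * ι N * δ0 (w // j))
      ≈⟨ ∑-sift j (λ w → ι (f w) * ι N) ⟩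
    ι (f j) * ι N ∎

  FT-injective : ∀ f g → (∀ z → FT f z ≈ FT g z) → ∀ j → f j ≡ g j
  FT-injective f g FTf≈FTg j = ℕₚ.*-cancelʳ-≡ (f j) (g j) N (ι-injective (f j ℕ.* N) (g j ℕ.* N) (begin
    ι (f j ℕ.* N)                         ≈⟨ ι-* (f j) N ⟩
    ι (f j) * ι N                         ≈⟨ FT-inversion f j ⟨
    sum (λ z → FT f z * conj (e j z))     ≈⟨ sum-cong-≋ {N} (λ z → *-congʳ {conj (e j z)} (FTf≈FTg z)) ⟩
    sum (λ z → FT g z * conj (e j z))     ≈⟨ FT-inversion g j ⟩
    ι (g j) * ι N                         ≈⟨ ι-* (g j) N ⟨
    ι (g j ℕ.* N)                         ∎))

  conj-FT : ∀ f z → conj (FT f z) ≈ sum (λ w → ι (f w) * conj (e w z))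
  conj-FT f z = trans (conj-sum (λ w → ι (f w) * e w z))
                      (sum-cong-≋ {N} (λ w → trans (conj.*-homo (ι (f w)) (e w z)) (*-congʳ (conj-ι (f w)))))
    where
      conj-sum : ∀ {n} (g : Fin n → Carrier) → conj (sum g) ≈ sum (λ i → conj (g i))
      conj-sum {zero}  g = conj.0#-homo
      conj-sum {suc n} g = trans (conj.+-homo (g F.zero) (sum (λ i → g (F.suc i)))) (+-congˡ (conj-sum (λ i → g (F.suc i))))

  module _ (X : Subset N) where

    open DihedralCayley m X using (χ; twoWalks; prescribed)
    open ∑-Reindexing m +-commutativeMonoid
    open import Algebra.Properties.CommutativeSemigroup *-commutativeSemigroup using (x∙yz≈y∙xz)
    open import Algebra.Properties.CommutativeMonoid.Sum ℕₚ.+-0-commutativeMonoid as ℕΣ using ()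
    open import Data.Bool using (Bool; true; false; if_then_else_)
    open import Data.Fin.Subset.Properties using (_∈?_)
    open import Data.List using (tabulate; foldr)
    open import Relation.Nullary using (does)

    r≈FTχ : ∀ z → r X z ≈ FT χ z
    r≈FTχ z = foldr-tabulate (λ i → i)
      where
        step : ∀ (b : Bool) x acc → (if b then x + acc else acc) ≈ ι (if b then 1 else 0) * x + acc
        step true  x acc = +-congʳ (sym (trans (*-congʳ (+-identityʳ 1#)) (*-identityˡ x)))
        step false x acc = sym (trans (+-congʳ (zeroˡ x)) (+-identityˡ acc))
        foldr-tabulate : ∀ {n} (h : Fin n → Fin N) →
          foldr (λ i acc → if does (i ∈? X) then e i z + acc else acc) 0# (tabulate h)
            ≈ sum (λ k → ι (χ (h k)) * e (h k) z)
        foldr-tabulate {zero}  h = refl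
        foldr-tabulate {suc n} h = trans (step (does (h F.zero ∈? X)) (e (h F.zero) z) _)
                                         (+-congˡ (foldr-tabulate (λ k → h (F.suc k))))

    FT-\\ : ∀ f u z → sum (λ w → ι (f (u \\ w)) * e w z) ≈ e u z * FT f z
    FT-\\ f u z = begin
      sum (λ w → ι (f (u \\ w)) * e w z)       ≈⟨ ∑-\\ u (λ a w → ι (f a) * e w z) ⟩
      sum (λ a → ι (f a) * e (u +ₘ a) z)       ≈⟨ sum-cong-≋ {N} (λ a → trans (*-congˡ (e-+ₘ u a z)) (x∙yz≈y∙xz (ι (f a)) (e u z) (e a z))) ⟩
      sum (λ a → e u z * (ι (f a) * e a z))    ≈⟨ *-distribˡ-sum (e u z) (λ a → ι (f a) * e a z) ⟨
      e u z * FT f z                           ∎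

    FT-// : ∀ f u z → sum (λ w → ι (f (u // w)) * e w z) ≈ e u z * conj (FT f z)
    FT-// f u z = begin
      sum (λ w → ι (f (u // w)) * e w z)              ≈⟨ ∑-// u (λ a w → ι (f a) * e w z) ⟩
      sum (λ a → ι (f a) * e (u // a) z)              ≈⟨ sum-cong-≋ {N} (λ a → trans (*-congˡ (e-// u a z)) (x∙yz≈y∙xz (ι (f a)) (e u z) (conj (e a z)))) ⟩
      sum (λ a → e u z * (ι (f a) * conj (e a z)))    ≈⟨ *-distribˡ-sum (e u z) (λ a → ι (f a) * conj (e a z)) ⟨
      e u z * sum (λ a → ι (f a) * conj (e a z))      ≈⟨ *-congˡ (conj-FT f z) ⟨
      e u z * conj (FT f z)                           ∎

    ι-sum : ∀ {n} (f : Fin n → ℕ) → ι (ℕΣ.sum f) ≈ sum (λ i → ι (f i))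
    ι-sum {zero}  f = refl
    ι-sum {suc n} f = trans (ι-+ (f F.zero) (ℕΣ.sum (λ i → f (F.suc i)))) (+-congˡ (ι-sum (λ i → f (F.suc i))))

    FT-twoWalks : ∀ z → FT twoWalks z ≈ FT χ z * (FT χ z + conj (FT χ z))
    FT-twoWalks z = begin
      sum (λ w → ι (twoWalks w) * e w z)
        ≈⟨ sum-cong-≋ {N} (λ w → trans (*-congʳ (ι-twoWalks w)) (*-distribʳ-sum (e w z) (walkTerm w))) ⟩
      sum (λ w → sum (λ u → walkTerm w u * e w z))
        ≈⟨ ∑-comm (λ w u → walkTerm w u * e w z) ⟩
      sum (λ u → sum (λ w → walkTerm w u * e w z))
        ≈⟨ sum-cong-≋ {N} walksFrom ⟩
      sum (λ u → ι (χ u) * e u z * (ρ + conj ρ))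
        ≈⟨ *-distribʳ-sum (ρ + conj ρ) (λ u → ι (χ u) * e u z) ⟨
      ρ * (ρ + conj ρ) ∎
      where
        ρ : Carrier
        ρ = FT χ z
        walkTerm : Fin N → Fin N → Carrier
        walkTerm w u = ι (χ u) * (ι (χ (u \\ w)) + ι (χ (u // w)))
        ι-twoWalks : ∀ w → ι (twoWalks w) ≈ sum (walkTerm w)
        ι-twoWalks w = trans (ι-sum (λ u → χ u ℕ.* (χ (u \\ w) ℕ.+ χ (u // w))))
          (sum-cong-≋ {N} (λ u → trans (ι-* (χ u) (χ (u \\ w) ℕ.+ χ (u // w))) (*-congˡ (ι-+ (χ (u \\ w)) (χ (u // w))))))
        walksFrom : ∀ u → sum (λ w → walkTerm w u * e w z) ≈ ι (χ u) * e u z * (ρ + conj ρ)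
        walksFrom u = begin
          sum (λ w → walkTerm w u * e w z)
            ≈⟨ sum-cong-≋ {N} (λ w → trans (*-assoc (ι (χ u)) (ι (χ (u \\ w)) + ι (χ (u // w))) (e w z)) (*-congˡ (distribʳ (e w z) (ι (χ (u \\ w))) (ι (χ (u // w)))))) ⟩
          sum (λ w → ι (χ u) * (ι (χ (u \\ w)) * e w z + ι (χ (u // w)) * e w z))
            ≈⟨ *-distribˡ-sum (ι (χ u)) (λ w → ι (χ (u \\ w)) * e w z + ι (χ (u // w)) * e w z) ⟨
          ι (χ u) * sum (λ w → ι (χ (u \\ w)) * e w z + ι (χ (u // w)) * e w z)
            ≈⟨ *-congˡ (∑-distrib-+ (λ w → ι (χ (u \\ w)) * e w z) (λ w → ι (χ (u // w)) * e w z)) ⟩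
          ι (χ u) * (sum (λ w → ι (χ (u \\ w)) * e w z) + sum (λ w → ι (χ (u // w)) * e w z))
            ≈⟨ *-congˡ (+-cong (FT-\\ χ u z) (FT-// χ u z)) ⟩
          ι (χ u) * (e u z * ρ + e u z * conj ρ)
            ≈⟨ *-congˡ (distribˡ (e u z) ρ (conj ρ)) ⟨
          ι (χ u) * (e u z * (ρ + conj ρ))
            ≈⟨ *-assoc (ι (χ u)) (e u z) (ρ + conj ρ) ⟨
          ι (χ u) * e u z * (ρ + conj ρ) ∎

    module _ (λ′ μ : ℕ) where

      ι-prescribed : ∀ w → ι (prescribed λ′ μ w) ≈ ι μ + (ι λ′ - ι μ) * ι (χ w)
      ι-prescribed w with does (w ∈? X)
      ... | true  = sym (begin
        ι μ + (ι λ′ - ι μ) * (1# + 0#)  ≈⟨ +-congˡ (trans (*-congˡ (+-identityʳ 1#)) (*-identityʳ (ι λ′ - ι μ))) ⟩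
        ι μ + (ι λ′ - ι μ)              ≈⟨ +-congˡ (+-comm (ι λ′) (- ι μ)) ⟩
        ι μ + (- ι μ + ι λ′)            ≈⟨ +-assoc (ι μ) (- ι μ) (ι λ′) ⟨
        ι μ - ι μ + ι λ′                ≈⟨ +-congʳ (-‿inverseʳ (ι μ)) ⟩
        0# + ι λ′                       ≈⟨ +-identityˡ (ι λ′) ⟩
        ι λ′                            ∎)
      ... | false = sym (trans (+-congˡ (zeroʳ (ι λ′ - ι μ))) (+-identityʳ (ι μ)))

      FT-prescribed : ∀ z → FT (prescribed λ′ μ) z ≈ ι μ * ι N * δ0 z + (ι λ′ - ι μ) * FT χ z
      FT-prescribed z = begin
        sum (λ w → ι (prescribed λ′ μ w) * e w z)
          ≈⟨ sum-cong-≋ {N} (λ w → trans (*-congʳ (ι-prescribed w)) (trans (distribʳ (e w z) (ι μ) _) (+-congˡ (*-assoc (ι λ′ - ι μ) (ι (χ w)) (e w z))))) ⟩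
        sum (λ w → ι μ * e w z + (ι λ′ - ι μ) * (ι (χ w) * e w z))
          ≈⟨ ∑-distrib-+ (λ w → ι μ * e w z) (λ w → (ι λ′ - ι μ) * (ι (χ w) * e w z)) ⟩
        sum (λ w → ι μ * e w z) + sum (λ w → (ι λ′ - ι μ) * (ι (χ w) * e w z))
          ≈⟨ +-cong (*-distribˡ-sum (ι μ) (λ w → e w z)) (*-distribˡ-sum (ι λ′ - ι μ) (λ w → ι (χ w) * e w z)) ⟨
        ι μ * sum (λ w → e w z) + (ι λ′ - ι μ) * FT χ z
          ≈⟨ +-congʳ (*-congˡ (trans (reflexive (sum-cong-≗ {N} (λ w → e-comm w z))) (orthogonality z))) ⟩
        ι μ * (ι N * δ0 z) + (ι λ′ - ι μ) * FT χ z
          ≈⟨ +-congʳ (*-assoc (ι μ) (ι N) (δ0 z)) ⟨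
        ι μ * ι N * δ0 z + (ι λ′ - ι μ) * FT χ z ∎

      twoWalks≡prescribed⇔ : (∀ z → twoWalks z ≡ prescribed λ′ μ z)
        ⇔ (∀ z → r X z * (r X z + conj (r X z)) ≈ ι μ * ι N * δ0 z + (ι λ′ - ι μ) * r X z)
      twoWalks≡prescribed⇔ = mk⇔
        (λ twoWalks≡prescribed z → begin
          r X z * (r X z + conj (r X z))             ≈⟨ r≈FTχ-square z ⟩
          FT χ z * (FT χ z + conj (FT χ z))          ≈⟨ FT-twoWalks z ⟨
          FT twoWalks z                              ≡⟨ sum-cong-≗ {N} (λ w → ≡.cong (λ k → ι k * e w z) (twoWalks≡prescribed w)) ⟩
          FT (prescribed λ′ μ) z                     ≈⟨ FT-prescribed z ⟩
          ι μ * ι N * δ0 z + (ι λ′ - ι μ) * FT χ z   ≈⟨ +-congˡ (*-congˡ (r≈FTχ z)) ⟨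
          ι μ * ι N * δ0 z + (ι λ′ - ι μ) * r X z    ∎)
        (λ spectral → FT-injective twoWalks (prescribed λ′ μ) (λ z → begin
          FT twoWalks z                              ≈⟨ FT-twoWalks z ⟩
          FT χ z * (FT χ z + conj (FT χ z))          ≈⟨ r≈FTχ-square z ⟨
          r X z * (r X z + conj (r X z))             ≈⟨ spectral z ⟩
          ι μ * ι N * δ0 z + (ι λ′ - ι μ) * r X z    ≈⟨ +-congˡ (*-congˡ (r≈FTχ z)) ⟩
          ι μ * ι N * δ0 z + (ι λ′ - ι μ) * FT χ z   ≈⟨ FT-prescribed z ⟨
          FT (prescribed λ′ μ) z                     ∎))
        where
          r≈FTχ-square : ∀ z → r X z * (r X z + conj (r X z)) ≈ FT χ z * (FT χ z + conj (FT χ z))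
          r≈FTχ-square z = *-cong (r≈FTχ z) (+-cong (r≈FTχ z) (conj.⟦⟧-cong (r≈FTχ z)))

lemma4p4 : {c ℓ : Level} (n : ℕ) → 1 ≤ n
    → (X : Subset n) → (∀ i → i ∈ X → toℕ i ≢ 0)
    → (C : CyclotomicSetting c ℓ n)
    → (μ λ′ t : ℕ)
    → let open Cyclotomic C in
      IsDSRG (elemsD n) _≟D_ (Dih n X X) (2 *ℕ n) (2 *ℕ ∣ X ∣) μ λ′ t
        ⇔ (t ≡ μ × (∀ (z : Fin n) → r X z * (r X z + conj (r X z))
                      ≈ ι μ * ι n * δ0 z + (ι λ′ - ι μ) * r X z))
lemma4p4 (suc m) _ X X-nonzero C μ λ′ t =
  ⇔.trans (DihedralCayley.isDSRG⇔ m X μ λ′ t (λ 0∈X → X-nonzero zero 0∈X _≡_.refl))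
          (⇔.refl ×-⇔ Fourier.twoWalks≡prescribed⇔ m C X λ′ μ)
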